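{- $\mathit{Micro}^{*}\neq\sigma\mathcal{P}$, where $\mathit{Micro}$ is the family of microscopic subsets of $2^\omega$ and $\sigma\mathcal{P}$ the family of $\sigma$-porous subsets of $2^\omega$.
   Context: $2^\omega$ is the Cantor space with coordinatewise addition modulo 2; $A+B=\{a+b:a\in A,b\in B\}$; $[\sigma]=\{x\in2^\omega:\sigma\subseteq x\}$. For $\mathcal{F}\subseteq\mathcal{P}(2^\omega)$, $\mathcal{F}^{*}=\{A\subseteq 2^\omega:\ \forall F\in\mathcal{F}\ \ A+F\neq 2^\omega\}$. $X$ is microscopic if for every $k\in\mathbb{N}$ there is a sequence $(\sigma_n)_{n\geq1}$ of finite binary sequences with $|\sigma_n|=kn$ and $X\subseteq\bigcup_n[\sigma_n]$. $X$ is porous if there exists $k$ such that for every $m$ and every $\alpha\in 2^m$ there is $\beta\in 2^{m+k}$ with $\alpha\subseteq\beta$ and $[\beta]\cap X=\emptyset$; $\sigma$-porous means a countable union of porous sets. -}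

module Defs where

open import Data.Nat using (ℕ; _+_; _*_; suc)
open import Data.Bool using (Bool; _xor_)
open import Data.Fin using (Fin; toℕ)
open import Data.Vec using (Vec; lookup)
open import Data.Product using (Σ; ∃; _×_)
open import Data.Empty using (⊥)
open import Relation.Nullary using (¬_)
open import Relation.Binary.PropositionalEquality using (_≡_)
open import Level using (Level; _⊔_) renaming (suc to lsuc; zero to lzero)

Cantor : Set
Cantor = ℕ → Bool

Subset : Set₁
Subset = Cantor → Set

_⊕_ : Subset → Subset → Subset
(A ⊕ B) x = Σ Cantor λ a → Σ Cantor λ b → A a × B b × (∀ i → x i ≡ (a i xor b i))

Full : Subset → Set
Full X = ∀ x → X x

Cyl : ∀ {n} → Vec Bool n → Subset
Cyl {n} σ x = ∀ (i : Fin n) → lookup σ i ≡ x (toℕ i)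

Prefix : ∀ {m n} → Vec Bool m → Vec Bool n → Set
Prefix {m} {n} α β = Σ (m Data.Nat.≤ n) λ _ → ∀ (i : Fin m) → ∀ (j : Fin n) → toℕ i ≡ toℕ j → lookup α i ≡ lookup β j

-- microscopic: for every k there are σ_n (n ≥ 1) with |σ_n| = k n and X ⊆ ⋃ [σ_n]
-- (index n ≥ 1 is written as suc n with n : ℕ)
Microscopic : Subset → Set
Microscopic X = ∀ (k : ℕ) → Σ ((n : ℕ) → Vec Bool (k * suc n)) λ σ →
  ∀ x → X x → ∃ λ n → Cyl (σ n) x

Porous : Subset → Set
Porous X = Σ ℕ λ k → ∀ (m : ℕ) (α : Vec Bool m) → Σ (Vec Bool (m + k)) λ β →
  Prefix α β × (∀ x → Cyl β x → ¬ X x)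

SigmaPorous : Subset → Set₁
SigmaPorous X = Σ (ℕ → Subset) λ P → (∀ n → Porous (P n)) ×
  (∀ x → (X x → ∃ λ n → P n x) × ((∃ λ n → P n x) → X x))

MicroStar : Subset → Set₁
MicroStar A = ∀ (F : Subset) → Microscopic F → ¬ Full (A ⊕ F)

{-# OPTIONS --safe #-}
-- Let A be the set of sequences vanishing on the range Z of an injection p : ℕ → ℕ.
-- If p n < k(n+1), then A ∈ Micro*: cover a microscopic F by cylinders [σ_n] with
-- |σ_n| = k(n+1) and let d disagree with σ_n at p n; were d = a + f with a ∈ A and
-- f ∈ [σ_n], then d (p n) = f (p n) = σ_n (p n). If moreover ℕ ∖ Z contains arbitrarily
-- long intervals arbitrarily far out, A is not σ-porous: a fusion argument builds a point
-- of A outside every porous P_i, placing the i-th porosity hole inside a long interval of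
-- ℕ ∖ Z, where membership in A imposes no constraint. Sending the j-th block of ℕ of
-- length j+1 to the start of the j-th block of length 2j+2 yields such a p with k = 2.
module Submission where

open import Defs
open import Data.Product using (∃-syntax; ∃₂; _×_; _,_; proj₁; proj₂)
open import Relation.Nullary using (¬_; contradiction)

open import Function using (_∘_; const)
open import Data.Nat using (ℕ; zero; suc; _+_; _*_; _≤_; _<_; _≤′_; ≤′-refl; ≤′-step; z≤n; s≤s)
open import Data.Nat.Properties
open import Data.Nat.Tactic.RingSolver using (solve-∀)
open import Data.Bool using (Bool; false; not; _xor_)
open import Data.Bool.Properties using (not-¬)
open import Data.Fin using (Fin; toℕ; fromℕ<; inject≤)
import Data.Fin as Fin
open import Data.Fin.Properties using (toℕ-fromℕ<; toℕ-inject≤; toℕ<n)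
open import Data.Vec using (Vec; []; _∷_; lookup; tabulate)
open import Data.Vec.Properties using (lookup∘tabulate)
open import Data.Sum using (_⊎_; inj₁; inj₂)
open import Relation.Binary.Definitions using (tri<; tri≈; tri>)
open import Relation.Binary.PropositionalEquality

_≈[_]_ : Cantor → ℕ → Cantor → Set
x ≈[ n ] y = ∀ t → t < n → x t ≡ y t

restrict : Cantor → (n : ℕ) → Vec Bool n
restrict x n = tabulate (x ∘ toℕ)

overwrite : ∀ {n} → Vec Bool n → Cantor → Cantor
overwrite []      x t       = x t
overwrite (b ∷ σ) x zero    = b
overwrite (b ∷ σ) x (suc t) = overwrite σ (x ∘ suc) t

Cyl-restrict : ∀ x n → Cyl (restrict x n) x
Cyl-restrict x n = lookup∘tabulate (x ∘ toℕ)

Cyl-overwrite : ∀ {n} (σ : Vec Bool n) x → Cyl σ (overwrite σ x)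
Cyl-overwrite (b ∷ σ) x Fin.zero    = refl
Cyl-overwrite (b ∷ σ) x (Fin.suc i) = Cyl-overwrite σ (x ∘ suc) i

overwrite-beyond : ∀ {n} (σ : Vec Bool n) x {t} → n ≤ t → overwrite σ x t ≡ x t
overwrite-beyond []      x _         = refl
overwrite-beyond (b ∷ σ) x (s≤s n≤t) = overwrite-beyond σ (x ∘ suc) n≤t

Cyl-agree : ∀ {n} {σ : Vec Bool n} {x y} → Cyl σ x → Cyl σ y → x ≈[ n ] y
Cyl-agree {n} {σ} {x} {y} x∈σ y∈σ t t<n = begin
  x t         ≡⟨ cong x (sym (toℕ-fromℕ< t<n)) ⟩
  x (toℕ i)   ≡⟨ sym (x∈σ i) ⟩
  lookup σ i  ≡⟨ y∈σ i ⟩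
  y (toℕ i)   ≡⟨ cong y (toℕ-fromℕ< t<n) ⟩
  y t         ∎
  where
  open ≡-Reasoning
  i : Fin n
  i = fromℕ< t<n

Cyl-≈ : ∀ {n} {σ : Vec Bool n} {x y} → Cyl σ y → x ≈[ n ] y → Cyl σ x
Cyl-≈ y∈σ x≈y i = trans (y∈σ i) (sym (x≈y (toℕ i) (toℕ<n i)))

Prefix-Cyl : ∀ {m n} {α : Vec Bool m} {β : Vec Bool n} {x} → Prefix α β → Cyl β x → Cyl α x
Prefix-Cyl {α = α} {β} {x} (m≤n , α⊑β) x∈β i = begin
  lookup α i           ≡⟨ α⊑β i j (sym (toℕ-inject≤ i m≤n)) ⟩
  lookup β j           ≡⟨ x∈β j ⟩
  x (toℕ j)            ≡⟨ cong x (toℕ-inject≤ i m≤n) ⟩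
  x (toℕ i)            ∎
  where
  open ≡-Reasoning
  j : Fin _
  j = inject≤ i m≤n

limit : (ℕ → Cantor) → Cantor
limit g t = g (suc t) t

module _ {g : ℕ → Cantor} {m : ℕ → ℕ}
         (m-increasing : ∀ i → m i < m (suc i))
         (g-coherent : ∀ i → g (suc i) ≈[ m i ] g i) where

  private
    m-mono : ∀ {i j} → i ≤′ j → m i ≤ m j
    m-mono ≤′-refl        = ≤-refl
    m-mono (≤′-step i≤j) = ≤-trans (m-mono i≤j) (<⇒≤ (m-increasing _))

    m-inflationary : ∀ i → i ≤ m i
    m-inflationary zero    = z≤n
    m-inflationary (suc i) = ≤-<-trans (m-inflationary i) (m-increasing i)

    g-stable : ∀ {i j} → i ≤′ j → g j ≈[ m i ] g i
    g-stable ≤′-refl             t t<mi = refl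
    g-stable (≤′-step {j} i≤j) t t<mi =
      trans (g-coherent j t (<-≤-trans t<mi (m-mono i≤j))) (g-stable i≤j t t<mi)

  limit-≈ : ∀ i → limit g ≈[ m i ] g i
  limit-≈ i t t<mi with ≤-total i (suc t)
  ... | inj₁ i≤1+t = g-stable (≤⇒≤′ i≤1+t) t t<mi
  ... | inj₂ 1+t≤i = sym (g-stable (≤⇒≤′ 1+t≤i) t (m-inflationary (suc t)))

VanishingOn : (ℕ → ℕ) → Subset
VanishingOn p a = ∀ n → a (p n) ≡ false

diagonal : ∀ {ℓ : ℕ → ℕ} → (∀ n → Vec Bool (ℓ n)) → (ℕ → ℕ) → Cantor
diagonal σ q t = not (overwrite (σ (q t)) (const false) t)

diagonal-escapes : ∀ {ℓ : ℕ → ℕ} (σ : ∀ n → Vec Bool (ℓ n)) q {n t x} →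
                   q t ≡ n → t < ℓ n → Cyl (σ n) x → diagonal σ q t ≡ not (x t)
diagonal-escapes σ q {t = t} {x} refl t<ℓn x∈σn =
  cong not (Cyl-agree {σ = σ (q t)} {overwrite (σ (q t)) (const false)} {x}
                      (Cyl-overwrite (σ (q t)) (const false)) x∈σn t t<ℓn)

vanishingOn-microStar : ∀ {p q : ℕ → ℕ} k → (∀ n → q (p n) ≡ n) → (∀ n → p n < k * suc n) →
                        MicroStar (VanishingOn p)
vanishingOn-microStar {p} {q} k q∘p≗id p<k*[1+n] F F-microscopic A+F-full
  with A+F-full (diagonal (proj₁ (F-microscopic k)) q)
... | a , f , a-vanishes , f∈F , d≡a+f with proj₂ (F-microscopic k) f f∈F
... | m , f∈[σm] =
  not-¬ (trans (d≡a+f (p m)) (cong (_xor f (p m)) (a-vanishes m)))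
        (diagonal-escapes (proj₁ (F-microscopic k)) q {x = f} (q∘p≗id m) (p<k*[1+n] m) f∈[σm])

HasGaps : (ℕ → ℕ) → Set
HasGaps p = ∀ m K → ∃[ W ] m < W × (∀ n → p n < W ⊎ W + K ≤ p n)

record Approximation (p : ℕ → ℕ) : Set where
  constructor approximation
  field
    length   : ℕ
    point    : Cantor
    vanishes : VanishingOn p point

open Approximation

record Refinement {p : ℕ → ℕ} (P : Subset) (a : Approximation p) : Set where
  field
    next    : Approximation p
    longer  : length a < length next
    extends : point next ≈[ length a ] point a
    avoids  : ∀ x → x ≈[ length next ] point next → ¬ P x

open Refinement

refine : ∀ {p : ℕ → ℕ} {P : Subset} → HasGaps p → Porous P → (a : Approximation p) → Refinement P a
refine {p} {P} gaps (K , holes) (approximation m g g-vanishes) = record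
  { next    = approximation (W + K) g′ g′-vanishes
  ; longer  = ≤-trans m<W (m≤m+n W K)
  ; extends = λ t t<m → g′≈g t (<-trans t<m m<W)
  ; avoids  = λ x x≈g′ → β-avoids x (Cyl-≈ {σ = β} {x} {g′} (Cyl-overwrite β g) x≈g′)
  }
  where
  W : ℕ
  W = proj₁ (gaps m K)

  m<W : m < W
  m<W = proj₁ (proj₂ (gaps m K))

  gap : ∀ n → p n < W ⊎ W + K ≤ p n
  gap = proj₂ (proj₂ (gaps m K))

  β : Vec Bool (W + K)
  β = proj₁ (holes W (restrict g W))

  β-extends : Prefix (restrict g W) β
  β-extends = proj₁ (proj₂ (holes W (restrict g W)))

  β-avoids : ∀ x → Cyl β x → ¬ P x
  β-avoids = proj₂ (proj₂ (holes W (restrict g W)))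

  g′ : Cantor
  g′ = overwrite β g

  g′≈g : g′ ≈[ W ] g
  g′≈g = Cyl-agree {σ = restrict g W} {g′} {g}
           (Prefix-Cyl {α = restrict g W} {β} {g′} β-extends (Cyl-overwrite β g))
           (Cyl-restrict g W)

  g′-vanishes : VanishingOn p g′
  g′-vanishes n with gap n
  ... | inj₁ pn<W    = trans (g′≈g (p n) pn<W) (g-vanishes n)
  ... | inj₂ W+K≤pn = trans (overwrite-beyond β g W+K≤pn) (g-vanishes n)

module _ {p : ℕ → ℕ} (gaps : HasGaps p) {P : ℕ → Subset} (porous : ∀ i → Porous (P i)) where

  private
    approximations : ℕ → Approximation p
    refinements : ∀ i → Refinement (P i) (approximations i)

    approximations zero    = approximation 0 (const false) (λ _ → refl)
    approximations (suc i) = next (refinements i)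

    refinements i = refine gaps (porous i) (approximations i)

    x : Cantor
    x = limit (point ∘ approximations)

  vanishingOn-escapes-porous : ∃[ x ] VanishingOn p x × (∀ i → ¬ P i x)
  vanishingOn-escapes-porous =
    x , (λ n → vanishes (approximations (suc (p n))) n) ,
    (λ i → avoids (refinements i) x (x≈approximations (suc i)))
    where
    x≈approximations : ∀ i → x ≈[ length (approximations i) ] point (approximations i)
    x≈approximations = limit-≈ (longer ∘ refinements) (extends ∘ refinements)

vanishingOn-not-σ-porous : ∀ {p : ℕ → ℕ} → HasGaps p → ¬ SigmaPorous (VanishingOn p)
vanishingOn-not-σ-porous gaps (P , porous , ∈A⇔∈⋃P)
  with vanishingOn-escapes-porous gaps porous
... | x , x-vanishes , x∉P with proj₁ (∈A⇔∈⋃P x) x-vanishes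
... | i , x∈Pi = x∉P i x∈Pi

module Blocks (last : ℕ → ℕ) where

  start : ℕ → ℕ
  start zero    = 0
  start (suc j) = start j + suc (last j)

  decompose : ∀ n → ∃₂ λ j r → r ≤ last j × start j + r ≡ n
  decompose zero = 0 , 0 , z≤n , refl
  decompose (suc n) with decompose n
  ... | j , r , r≤last , refl with m≤n⇒m<n∨m≡n r≤last
  ...   | inj₁ r<last = j , suc r , r<last , +-suc (start j) r
  ...   | inj₂ refl   = suc j , 0 , z≤n , trans (+-identityʳ _) (+-suc (start j) r)

  start-mono-≤ : ∀ {j j′} → j ≤ j′ → start j ≤ start j′
  start-mono-≤ = mono ∘ ≤⇒≤′
    where
    mono : ∀ {j j′} → j ≤′ j′ → start j ≤ start j′
    mono ≤′-refl        = ≤-refl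
    mono (≤′-step j≤j′) = ≤-trans (mono j≤j′) (m≤m+n _ _)

  offset<start : ∀ {j j′ r} → r ≤ last j → j < j′ → start j + r < start j′
  offset<start {j} r≤last j<j′ = <-≤-trans (+-monoʳ-< (start j) (s≤s r≤last)) (start-mono-≤ j<j′)

  decompose-unique : ∀ {j j′ r r′} → r ≤ last j → r′ ≤ last j′ → start j + r ≡ start j′ + r′ →
                     j ≡ j′ × r ≡ r′
  decompose-unique {j} {j′} {r} {r′} r≤ r′≤ eq with <-cmp j j′
  ... | tri≈ _ refl _ = refl , +-cancelˡ-≡ (start j) r r′ eq
  ... | tri< j<j′ _ _ =
    contradiction eq (<⇒≢ (<-≤-trans (offset<start r≤ j<j′) (m≤m+n (start j′) r′)))
  ... | tri> _ _ j′<j =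
    contradiction (sym eq) (<⇒≢ (<-≤-trans (offset<start r′≤ j′<j) (m≤m+n (start j) r)))

module BlockEmbedding (short long : ℕ → ℕ) (short≤long : ∀ j → short j ≤ long j) where

  module S = Blocks short
  module L = Blocks long

  embed : ℕ → ℕ
  embed n with S.decompose n
  ... | j , r , _ = L.start j + r

  project : ℕ → ℕ
  project t with L.decompose t
  ... | j , r , _ = S.start j + r

  project∘embed : ∀ n → project (embed n) ≡ n
  project∘embed n with S.decompose n
  ... | j , r , r≤short , refl with L.decompose (L.start j + r)
  ... | j′ , r′ , r′≤long , eq
    with L.decompose-unique r′≤long (≤-trans r≤short (short≤long j)) eq
  ... | refl , refl = refl

  embed-misses-tail : ∀ n j → embed n < L.start j + suc (short j) ⊎ L.start (suc j) ≤ embed n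
  embed-misses-tail n j with S.decompose n
  ... | j′ , r , r≤short , _ with <-cmp j′ j
  ... | tri< j′<j _ _ =
    inj₁ (<-≤-trans (L.offset<start (≤-trans r≤short (short≤long j′)) j′<j) (m≤m+n _ _))
  ... | tri≈ _ refl _ = inj₁ (+-monoʳ-< (L.start j) (s≤s r≤short))
  ... | tri> _ _ j<j′ = inj₂ (≤-trans (L.start-mono-≤ j<j′) (m≤m+n _ _))

open BlockEmbedding (λ j → j) (λ j → suc (j + j)) (λ j → ≤-trans (m≤m+n j j) (n≤1+n _))

long-start≡2*short-start : ∀ j → L.start j ≡ 2 * S.start j
long-start≡2*short-start zero    = refl
long-start≡2*short-start (suc j) = begin
  L.start j + suc (suc (j + j))    ≡⟨ cong (_+ suc (suc (j + j))) (long-start≡2*short-start j) ⟩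
  2 * S.start j + suc (suc (j + j)) ≡⟨ double (S.start j) j ⟩
  2 * (S.start j + suc j)           ∎
  where
  open ≡-Reasoning
  double : ∀ s j → 2 * s + suc (suc (j + j)) ≡ 2 * (s + suc j)
  double = solve-∀

embed<2*[1+n] : ∀ n → embed n < 2 * suc n
embed<2*[1+n] n with S.decompose n
... | j , r , _ , refl rewrite long-start≡2*short-start j =
  subst (suc (2 * S.start j + r) ≤_) (sym (split (S.start j) r)) (m≤m+n _ _)
  where
  split : ∀ s r → 2 * suc (s + r) ≡ suc (2 * s + r) + suc r
  split = solve-∀

embed-hasGaps : HasGaps embed
embed-hasGaps m K = L.start j + suc j , m<W , misses
  where
  j : ℕ
  j = m + K

  m<W : m < L.start j + suc j
  m<W = ≤-trans (s≤s (m≤m+n m K)) (m≤n+m (suc j) (L.start j))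

  window≤next-start : L.start j + suc j + K ≤ L.start (suc j)
  window≤next-start = begin
    L.start j + suc j + K          ≡⟨ +-assoc (L.start j) (suc j) K ⟩
    L.start j + (suc j + K)        ≤⟨ +-monoʳ-≤ (L.start j) (+-monoʳ-≤ (suc j) (m≤n+m K m)) ⟩
    L.start j + (suc j + j)        ≤⟨ +-monoʳ-≤ (L.start j) (n≤1+n _) ⟩
    L.start j + suc (suc (j + j))  ∎
    where open ≤-Reasoning

  misses : ∀ n → embed n < L.start j + suc j ⊎ L.start j + suc j + K ≤ embed n
  misses n with embed-misses-tail n j
  ... | inj₁ below      = inj₁ below
  ... | inj₂ next≤embed = inj₂ (≤-trans window≤next-start next≤embed)

mainTheorem14 : ¬ (∀ (A : Subset) → (MicroStar A → SigmaPorous A) × (SigmaPorous A → MicroStar A))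
mainTheorem14 Micro*≡σP =
  vanishingOn-not-σ-porous embed-hasGaps
    (proj₁ (Micro*≡σP (VanishingOn embed))
      (vanishingOn-microStar {embed} {project} 2 project∘embed embed<2*[1+n]))
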